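{- Let $\mathcal{E}\colon(X=P_X)_{X\in\mathbf{X}}$ be a polynomial equation system over an absorptive, fully-continuous commutative semiring $K$ with $\ell=|\mathbf{X}|$ indeterminates, and let $X\in\mathbf{X}$. For each $T\in\mathcal{T}(\mathcal{E},X)$ there is a derivation tree $T'\in\mathcal{T}(\mathcal{E},X)$ such that every subtree of $T'$ rooted at a node of depth $\ell$ is deterministic and uses only pairs $(m,Y)$ (with $Y\in\mathbf{X}$, $m$ a monomial of $P_Y$, i.e. nodes $v$ with $\mathsf{var}(v)=Y$, $\mathsf{mon}(v)=m$) that occur infinitely often in $T$ (i.e. $|T|_{m,Y}=\infty$). Moreover, $|T'|_{m,Y}\le|T|_{m,Y}$ for all $Y\in\mathbf{X}$ and all monomials $m$ of $P_Y$.
   Context: Absorptive: $1+a=1$; natural order $a\le b$ iff $a+b=b$; fully continuous: $\le$ is a complete lattice and $+$, $\cdot$ with a fixed element commute with suprema and infima of nonempty chains. A polynomial equation system assigns to each $X\in\mathbf{X}$ a polynomial $P_X$ (finite sum $\sum c_im_i$ of distinct monomials $m_i\colon\mathbf{X}\to\mathbb{N}$, coefficients $c_i\ne0$; write $c\cdot m\in P$). A derivation tree $T=(V,E,\mathsf{var},\mathsf{yd})$ is a rooted, possibly infinite tree with $\mathsf{var}\colon V\to\mathbf{X}$, $\mathsf{yd}\colon V\to K$; $\mathsf{mon}(v)=\prod_{w\text{ child of }v}\mathsf{var}(w)$; compatible with $\mathcal{E}$ if $\mathsf{yd}(v)\cdot\mathsf{mon}(v)\in P_{\mathsf{var}(v)}$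 for all $v$; $\mathcal{T}(\mathcal{E},X)$: compatible trees with root labeled $X$. A tree is deterministic if $\mathsf{mon}(v)$ depends only on $\mathsf{var}(v)$. $|T|_{m,Y}\in\mathbb{N}\cup\{\infty\}$ is the number of nodes $v$ of $T$ with $\mathsf{var}(v)=Y$ and $\mathsf{mon}(v)=m$. -}

module Defs where

open import Level using (Level; _⊔_)
open import Algebra.Bundles using (CommutativeSemiring)
open import Data.Nat using (ℕ; _<_)
open import Data.Fin using (Fin)
open import Data.Fin.Properties using (_≟_)
open import Data.Vec using (Vec; tabulate)
open import Data.List using (List; []; _∷_; _++_; length; upTo; filter; map)
open import Data.List.Relation.Unary.Any using (Any)
open import Data.List.Relation.Unary.All using (All)
open import Data.List.Relation.Unary.Unique.Propositional using (Unique)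
open import Data.Product using (Σ; ∃; _×_; _,_; proj₁; proj₂)
open import Data.Sum using (_⊎_)
open import Data.Unit using (⊤)
open import Relation.Nullary using (¬_)
open import Relation.Unary using (Pred)
open import Relation.Binary.PropositionalEquality using (_≡_)
open import Function.Definitions using (Injective)

module _ {c ℓ : Level} (R : CommutativeSemiring c ℓ) where
  open CommutativeSemiring R

  Absorptive : Set (c ⊔ ℓ)
  Absorptive = ∀ a → 1# + a ≈ 1#

  _≤ₙ_ : Carrier → Carrier → Set ℓ
  a ≤ₙ b = a + b ≈ b

  SubsetK : Set (Level.suc (c ⊔ ℓ))
  SubsetK = Pred Carrier (c ⊔ ℓ)

  IsUB : SubsetK → Carrier → Set (c ⊔ ℓ)
  IsUB S u = ∀ x → S x → x ≤ₙ u

  IsLUB : SubsetK → Carrier → Set (c ⊔ ℓ)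
  IsLUB S u = IsUB S u × (∀ v → IsUB S v → u ≤ₙ v)

  IsLB : SubsetK → Carrier → Set (c ⊔ ℓ)
  IsLB S u = ∀ x → S x → u ≤ₙ x

  IsGLB : SubsetK → Carrier → Set (c ⊔ ℓ)
  IsGLB S u = IsLB S u × (∀ v → IsLB S v → v ≤ₙ u)

  IsChain : SubsetK → Set (c ⊔ ℓ)
  IsChain S = ∀ x y → S x → S y → (x ≤ₙ y) ⊎ (y ≤ₙ x)

  Nonempty : SubsetK → Set (c ⊔ ℓ)
  Nonempty S = ∃ S

  image : (Carrier → Carrier) → SubsetK → SubsetK
  image f S y = ∃ λ x → S x × y ≈ f x

  FullyContinuous : Set (Level.suc (c ⊔ ℓ))
  FullyContinuous =
    (∀ S → ∃ (IsLUB S)) × (∀ S → ∃ (IsGLB S)) ×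
    (∀ S → Nonempty S → IsChain S → ∀ a →
      (∀ s → IsLUB S s → IsLUB (image (a +_) S) (a + s) × IsLUB (image (a *_) S) (a * s)) ×
      (∀ s → IsGLB S s → IsGLB (image (a +_) S) (a + s) × IsGLB (image (a *_) S) (a * s)))

Monomial : ℕ → Set
Monomial k = Vec ℕ k          -- exponent vector m : X → ℕ

module _ {c ℓ : Level} (R : CommutativeSemiring c ℓ) where
  open CommutativeSemiring R

  Polynomial : ℕ → Set c
  Polynomial k = List (Carrier × Monomial k)

  record EqSystem (k : ℕ) : Set (c ⊔ ℓ) where
    field
      P        : Fin k → Polynomial k
      distinct : ∀ X → Unique (map proj₂ (P X))
      nonzero  : ∀ X → All (λ cm → ¬ (proj₁ cm ≈ 0#)) (P X)

  _·_∈P_ : ∀ {k} → Carrier → Monomial k → Polynomial k → Set (c ⊔ ℓ)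
  a · m ∈P P = Any (λ cm → (a ≈ proj₁ cm) × (m ≡ proj₂ cm)) P

  MonOf : ∀ {k} → Monomial k → Polynomial k → Set c
  MonOf m P = Any (λ cm → m ≡ proj₂ cm) P

-- Possibly infinite, finitely branching, rooted labelled trees.
-- Nodes are addresses: [] is the root, (i ∷ p) is the i-th child of p.

Address : Set
Address = List ℕ

record Tree {c : Level} (K : Set c) (k : ℕ) : Set c where
  field
    var   : Address → Fin k
    yd    : Address → K
    arity : Address → ℕ

module _ {c : Level} {K : Set c} {k : ℕ} (T : Tree K k) where
  open Tree T

  Node : Address → Set
  Node []      = ⊤
  Node (i ∷ p) = Node p × i < arity p

  -- mon(v) = product of the variables of the children of v (exponent vector)
  mon : Address → Monomial k
  mon p = tabulate λ Y → length (filter (λ i → var (i ∷ p) ≟ Y) (upTo (arity p)))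

  -- |T|_{m,Y} ≥ n : there are n distinct nodes v with var v = Y, mon v = m
  AtLeast : ℕ → Monomial k → Fin k → Set
  AtLeast n m Y = Σ (Fin n → Address) λ f →
    Injective _≡_ _≡_ f × (∀ i → Node (f i) × var (f i) ≡ Y × mon (f i) ≡ m)

  InfinitelyOften : Monomial k → Fin k → Set
  InfinitelyOften m Y = ∀ n → AtLeast n m Y

_≼_ : Address → Address → Set
u ≼ v = ∃ λ q → u ≡ q ++ v

DeterministicAt : ∀ {c} {K : Set c} {k} → Tree K k → Address → Set
DeterministicAt T v = ∀ u w → Node T u → Node T w → u ≼ v → w ≼ v →
  Tree.var T u ≡ Tree.var T w → mon T u ≡ mon T w

Compatible : ∀ {c ℓ} (R : CommutativeSemiring c ℓ) {k} →
  EqSystem R k → Fin k → Tree (CommutativeSemiring.Carrier R) k → Set (c ⊔ ℓ)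
Compatible R E X T =
  Tree.var T [] ≡ X ×
  (∀ p → Node T p → _·_∈P_ R (Tree.yd T p) (mon T p) (EqSystem.P E (Tree.var T p)))

{-# OPTIONS --safe #-}
-- Call Y recurrent if some pair (m, Y) occurs infinitely often in T. T' is built
-- top-down, each node copying a node of T with the same variable: a node with a
-- recurrent variable Y copies one fixed occurrence of a recurrent pair (m, Y), whose
-- children again have recurrent variables (infinitely many nodes share the monomial
-- m); any other node copies the lowest descendant with the same variable, which
-- exists because a non-recurrent variable occurs only finitely often. Hence no
-- variable repeats along a path of non-recurrent nodes of T', so every node at
-- depth ℓ is recurrent and the subtree below it is deterministic and uses only pairs
-- occurring infinitely often. On non-recurrent nodes the copying map is injective,
-- which gives |T'|_{m,Y} ≤ |T|_{m,Y}.
module Submission where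

open import Defs
open import Level using (Level; _⊔_; Lift; lift; lower)
open import Algebra.Bundles using (CommutativeSemiring)
open import Axiom.ExcludedMiddle using (ExcludedMiddle)
open import Data.Nat using (ℕ; zero; suc; _+_; _≤_; _<_; z≤n; s≤s)
open import Data.Nat.Properties
  using (≤-trans; <-trans; <-cmp; <⇒≢; <⇒≱; ≤-pred; m≤n+m; m≤m+n; m<1+n⇒m<n∨m≡n; n<1+n; ≤-refl; <-irrefl; ≰⇒>; _≤?_)
open import Data.Fin using (Fin; toℕ)
open import Data.Fin.Properties using (_≟_; toℕ-injective; toℕ<n; pigeonhole)
open import Data.Vec using (lookup)
open import Data.Vec.Properties using (lookup∘tabulate; tabulate-cong)
open import Data.List using (List; []; _∷_; _++_; length; upTo; drop; take; map)
open import Data.List.Properties using (length-++; ++-assoc; ++-identityʳ; ∷-injective; ∷-injectiveˡ; take++drop≡id; filter-≐)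
open import Data.List.Membership.Propositional using (_∈_)
open import Data.List.Membership.Propositional.Properties using (∈-filter⁺; ∈-filter⁻; ∈-upTo⁺; ∈-upTo⁻)
open import Data.List.Relation.Unary.Any using (here; tail)
import Data.List.Relation.Unary.Any as Any
open import Data.List.Relation.Unary.Any.Properties using (map⁺)
open import Data.Product using (Σ; ∃; ∃₂; _×_; _,_; proj₁; proj₂)
open import Data.Sum using (inj₁; inj₂; _⊎_)
open import Data.Empty using (⊥-elim)
open import Data.Unit using (tt)
open import Function using (_∘_)
open import Function.Definitions using (Injective)
open import Relation.Nullary using (¬_; Dec; yes; no)
open import Relation.Nullary.Decidable using (map′)
open import Relation.Binary using (tri<; tri≈; tri>)
open import Relation.Binary.PropositionalEquality using (_≡_; refl; sym; trans; cong; subst; module ≡-Reasoning)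

private
  variable
    a c ℓ : Level
    k : ℕ

increasing⇒monotone : (f : ℕ → ℕ) → (∀ n → f n < f (suc n)) → ∀ {m n} → m < n → f m < f n
increasing⇒monotone f f-inc {n = suc n} m<1+n with m<1+n⇒m<n∨m≡n m<1+n
... | inj₁ m<n  = <-trans (increasing⇒monotone f f-inc m<n) (f-inc n)
... | inj₂ refl = f-inc n

increasing⇒injective : (f : ℕ → ℕ) → (∀ n → f n < f (suc n)) → Injective _≡_ _≡_ f
increasing⇒injective f f-inc {m} {n} fm≡fn with <-cmp m n
... | tri< m<n _ _ = ⊥-elim (<⇒≢ (increasing⇒monotone f f-inc m<n) fm≡fn)
... | tri≈ _ m≡n _ = m≡n
... | tri> _ _ n<m = ⊥-elim (<⇒≢ (increasing⇒monotone f f-inc n<m) (sym fm≡fn))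

length-positive⇒∈ : ∀ {A : Set} {xs : List A} → 0 < length xs → ∃ (_∈ xs)
length-positive⇒∈ {xs = x ∷ _} _ = x , here refl

∈⇒length-positive : ∀ {A : Set} {x : A} {xs} → x ∈ xs → 0 < length xs
∈⇒length-positive {xs = _ ∷ _} _ = s≤s z≤n

Cofinal : (ℕ → Set) → Set
Cofinal P = ∀ n → ∃ λ i → n ≤ i × P i

cofinal-shift : ∀ {P : ℕ → Set} N → Cofinal (P ∘ (N +_)) → Cofinal P
cofinal-shift N cof n with i , n≤i , Pi ← cof n = N + i , ≤-trans n≤i (m≤n+m i N) , Pi

cofinal⇒subsequence : ∀ {P : ℕ → Set} → Cofinal P →
  Σ (ℕ → ℕ) λ σ → Injective _≡_ _≡_ σ × (∀ n → P (σ n))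
cofinal⇒subsequence {P} cof = σ , increasing⇒injective σ (proj₁ ∘ proj₂ ∘ cof ∘ suc ∘ σ) , P-σ
  where
  σ : ℕ → ℕ
  σ zero    = proj₁ (cof 0)
  σ (suc n) = proj₁ (cof (suc (σ n)))
  P-σ : ∀ n → P (σ n)
  P-σ zero    = proj₂ (proj₂ (cof 0))
  P-σ (suc n) = proj₂ (proj₂ (cof (suc (σ n))))

module Classical (em : ExcludedMiddle a) where

  decide : (P : Set) → Dec P
  decide P = map′ lower lift (em {Lift a P})

  ¬cofinal⇒eventually : ∀ {P : ℕ → Set} → ¬ Cofinal P → ∃ λ N → ∀ i → N ≤ i → ¬ P i
  ¬cofinal⇒eventually {P} ¬cof with decide (∃ λ N → ∀ i → N ≤ i → ¬ P i)
  ... | yes eventually = eventually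
  ... | no ¬eventually = ⊥-elim (¬cof beyond)
    where
    beyond : Cofinal P
    beyond n with decide (∃ λ i → n ≤ i × P i)
    ... | yes Pi = Pi
    ... | no ¬Pi = ⊥-elim (¬eventually (n , λ i n≤i Pi → ¬Pi (i , n≤i , Pi)))

  cofinal-pigeonhole : ∀ {B : Set} (xs : List B) (f : ℕ → B) → (∀ i → f i ∈ xs) →
    ∃ λ b → Cofinal (λ i → f i ≡ b)
  cofinal-pigeonhole [] f f∈ with () ← f∈ 0
  cofinal-pigeonhole (x ∷ xs) f f∈ with decide (Cofinal (λ i → f i ≡ x))
  ... | yes cof = x , cof
  ... | no ¬cof with N , ≢x ← ¬cofinal⇒eventually ¬cof
      with b , cof ← cofinal-pigeonhole xs (f ∘ (N +_)) (λ i → tail (≢x (N + i) (m≤m+n N i)) (f∈ (N + i)))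
      = b , cofinal-shift N cof

_≺_ : Address → Address → Set
u ≺ v = ∃₂ λ r j → u ≡ r ++ j ∷ v

≼-refl : ∀ {u} → u ≼ u
≼-refl = [] , refl

≼-trans : ∀ {u v w} → u ≼ v → v ≼ w → u ≼ w
≼-trans {w = w} (q , refl) (q′ , refl) = q ++ q′ , sym (++-assoc q q′ w)

∷-≼ : ∀ j u → (j ∷ u) ≼ u
∷-≼ j u = j ∷ [] , refl

≺⇒≼ : ∀ {u v} → u ≺ v → u ≼ v
≺⇒≼ (r , j , refl) = ≼-trans (r , refl) (∷-≼ j _)

∷-≼⇒≺ : ∀ x {u v} → u ≼ v → (x ∷ u) ≺ v
∷-≼⇒≺ x ([] , refl) = [] , x , refl
∷-≼⇒≺ x (y ∷ q , refl) with r , j , eq ← ∷-≼⇒≺ y (q , refl) = x ∷ r , j , cong (x ∷_) eq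

≼⇒≡⊎≺ : ∀ {u v} → u ≼ v → u ≡ v ⊎ u ≺ v
≼⇒≡⊎≺ ([] , refl)    = inj₁ refl
≼⇒≡⊎≺ (x ∷ q , refl) = inj₂ (∷-≼⇒≺ x (q , refl))

≼-length : ∀ {u v} → u ≼ v → length v ≤ length u
≼-length {v = v} (q , refl) = subst (length v ≤_) (sym (length-++ q)) (m≤n+m (length v) (length q))

≺-length : ∀ {u v} → u ≺ v → length v < length u
≺-length (r , j , refl) = ≼-length (r , refl)

≼-antisym : ∀ {u v} → u ≼ v → v ≼ u → u ≡ v
≼-antisym u≼v v≼u with ≼⇒≡⊎≺ u≼v
... | inj₁ u≡v = u≡v
... | inj₂ u≺v = ⊥-elim (<⇒≱ (≺-length u≺v) (≼-length v≼u))

common-descendant-≼ : ∀ {w u v} → w ≼ u → w ≼ v → length u ≤ length v → v ≼ u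
common-descendant-≼ (t , refl) (t′ , eq) = suffix t t′ eq
  where
  suffix : ∀ t t′ {u v} → t ++ u ≡ t′ ++ v → length u ≤ length v → v ≼ u
  suffix t        []       eq _   = t , sym eq
  suffix []       (x ∷ t′) refl u≤v = ⊥-elim (<⇒≱ (≺-length (∷-≼⇒≺ x (t′ , refl))) u≤v)
  suffix (_ ∷ t)  (_ ∷ t′) eq u≤v = suffix t t′ (proj₂ (∷-injective eq)) u≤v

siblings-≼ : ∀ {w u i j} → w ≼ (i ∷ u) → w ≼ (j ∷ u) → i ≡ j
siblings-≼ {u = u} w≼iu w≼ju with ≼⇒≡⊎≺ (common-descendant-≼ w≼iu w≼ju (≤-refl {suc (length u)}))
... | inj₁ ju≡iu = sym (∷-injectiveˡ ju≡iu)
... | inj₂ ju≺iu = ⊥-elim (<-irrefl refl (≺-length ju≺iu))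

drop-≼ : ∀ n (p : Address) → p ≼ drop n p
drop-≼ n p = take n p , sym (take++drop≡id n p)

drop-≺ : ∀ {i j} (p : Address) → i < j → j ≤ length p → drop i p ≺ drop j p
drop-≺ {zero}  {suc j} (x ∷ p) _         _         = ∷-≼⇒≺ x (drop-≼ j p)
drop-≺ {suc i} {suc j} (x ∷ p) (s≤s i<j) (s≤s j≤) = drop-≺ p i<j j≤

-- Walks down a path of T' and relocates every node by g.
follow : (Address → Address) → Address → Address
follow g []      = g []
follow g (i ∷ p) = g (i ∷ follow g p)

module _ {g : Address → Address} (g-≼ : ∀ u → g u ≼ u) where

  follow-descends : ∀ r j v → follow g (r ++ j ∷ v) ≼ (j ∷ follow g v)
  follow-descends []      j v = g-≼ (j ∷ follow g v)
  follow-descends (i ∷ r) j v =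
    ≼-trans (g-≼ (i ∷ follow g (r ++ j ∷ v))) (≼-trans (∷-≼ i _) (follow-descends r j v))

  follow-≺-length : ∀ {u v} → u ≺ v → length (follow g v) < length (follow g u)
  follow-≺-length (r , j , refl) = ≼-length (follow-descends r j _)

  follow-≼-antisym : ∀ {u v} → v ≼ u → follow g u ≼ follow g v → v ≡ u
  follow-≼-antisym v≼u fu≼fv with ≼⇒≡⊎≺ v≼u
  ... | inj₁ v≡u = v≡u
  ... | inj₂ v≺u = ⊥-elim (<⇒≱ (follow-≺-length v≺u) (≼-length fu≼fv))

  -- follow g u and follow g v both lie above follow g (i ∷ u), so one lies above the other.
  follow-reflects-≼ : ∀ u v → follow g u ≼ follow g v → u ≼ v
  follow-reflects-≼ [] v f[]≼fv with refl ← follow-≼-antisym (v , sym (++-identityʳ v)) f[]≼fv = ≼-refl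
  follow-reflects-≼ (i ∷ u) v fiu≼fv with length (follow g v) ≤? length (follow g u)
  ... | yes fv≤fu = ≼-trans (∷-≼ i u) (follow-reflects-≼ u v (common-descendant-≼ fiu≼fv fiu≼fu fv≤fu))
    where
    fiu≼fu : follow g (i ∷ u) ≼ follow g u
    fiu≼fu = ≼-trans (g-≼ (i ∷ follow g u)) (∷-≼ i _)
  ... | no fv≰fu
      with fv≼ifu ← common-descendant-≼ (g-≼ (i ∷ follow g u)) fiu≼fv (≰⇒> fv≰fu)
      with ≼⇒≡⊎≺ (follow-reflects-≼ v u (≼-trans fv≼ifu (∷-≼ i _)))
  ...   | inj₁ refl = ⊥-elim (fv≰fu ≤-refl)
  ...   | inj₂ (r , j , refl) with refl ← siblings-≼ fv≼ifu (follow-descends r j u) =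
    [] , sym (follow-≼-antisym (r , refl) fiu≼fv)

  follow-injective : Injective _≡_ _≡_ (follow g)
  follow-injective {u} {v} fu≡fv =
    ≼-antisym (follow-reflects-≼ u v (subst (_ ≼_) fu≡fv ≼-refl))
              (follow-reflects-≼ v u (subst (_≼ _) fu≡fv ≼-refl))

record InfinitelyMany (P : Address → Set) : Set where
  field
    elem           : ℕ → Address
    elem-injective : Injective _≡_ _≡_ elem
    elem-satisfies : ∀ n → P (elem n)

open InfinitelyMany

relabel : ∀ {K : Set c} → (Address → Address) → Tree K k → Tree K k
relabel f T = record { var = Tree.var T ∘ f ; yd = Tree.yd T ∘ f ; arity = Tree.arity T ∘ f }

module _ {K : Set c} (T : Tree K k) where
  open Tree T

  Node-≼ : ∀ {u v} → u ≼ v → Node T u → Node T v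
  Node-≼ ([] , refl)    u-node       = u-node
  Node-≼ (_ ∷ q , refl) (u-node , _) = Node-≼ (q , refl) u-node

  Occurrence : Monomial k → Fin k → Address → Set
  Occurrence m Y v = Node T v × var v ≡ Y × mon T v ≡ m

  InfinitelyMany⇒InfinitelyOften : ∀ {m Y} → InfinitelyMany (Occurrence m Y) → InfinitelyOften T m Y
  InfinitelyMany⇒InfinitelyOften occ n =
    elem occ ∘ toℕ , toℕ-injective ∘ elem-injective occ , elem-satisfies occ ∘ toℕ

  child⇒mon-positive : ∀ {p i} → i < arity p → 0 < lookup (mon T p) (var (i ∷ p))
  child⇒mon-positive {p} {i} i<arity = subst (0 <_) (sym (lookup∘tabulate _ (var (i ∷ p))))
    (∈⇒length-positive (∈-filter⁺ (λ j → var (j ∷ p) ≟ var (i ∷ p)) (∈-upTo⁺ i<arity) refl))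

  mon-positive⇒child : ∀ {p Y} → 0 < lookup (mon T p) Y → ∃ λ j → j < arity p × var (j ∷ p) ≡ Y
  mon-positive⇒child {p} {Y} positive
    with j , j∈ ← length-positive⇒∈ (subst (0 <_) (lookup∘tabulate _ Y) positive)
    with j∈upTo , j-var ← ∈-filter⁻ (λ j → var (j ∷ p) ≟ Y) {xs = upTo (arity p)} j∈
    = j , ∈-upTo⁻ j∈upTo , j-var

  mon-≡⇒child : ∀ {p p′ i} → mon T p ≡ mon T p′ → i < arity p′ →
    ∃ λ j → j < arity p × var (j ∷ p) ≡ var (i ∷ p′)
  mon-≡⇒child same i<arity =
    mon-positive⇒child (subst (λ m → 0 < lookup m _) (sym same) (child⇒mon-positive i<arity))

  mon-relabel : ∀ f p → (∀ i → var (f (i ∷ p)) ≡ var (i ∷ f p)) → mon (relabel f T) p ≡ mon T (f p)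
  mon-relabel f p same = tabulate-cong λ Y → cong length
    (filter-≐ (λ i → var (f (i ∷ p)) ≟ Y) (λ i → var (i ∷ f p) ≟ Y)
      ((λ {i} → trans (sym (same i))) , (λ {i} → trans (same i)))
      (upTo (arity (f p))))

module _ (R : CommutativeSemiring c ℓ) (E : EqSystem R k) {X : Fin k} {T : Tree (CommutativeSemiring.Carrier R) k} where
  open EqSystem E using (P)

  compatible⇒mon-∈ : Compatible R E X T → ∀ v → Node T v → mon T v ∈ map proj₂ (P (Tree.var T v))
  compatible⇒mon-∈ (_ , nodes) v v-node = map⁺ (Any.map proj₂ (nodes v v-node))

  relabel-compatible : ∀ f → Compatible R E X T → Tree.var T (f []) ≡ Tree.var T [] →
    (∀ {p} → Node (relabel f T) p → Node T (f p)) → (∀ p → mon (relabel f T) p ≡ mon T (f p)) →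
    Compatible R E X (relabel f T)
  relabel-compatible f (root , nodes) root-var f-node f-mon = trans root-var root , λ p p-node →
    subst (λ m → _·_∈P_ R (Tree.yd T (f p)) m (P (Tree.var T (f p)))) (sym (f-mon p)) (nodes (f p) (f-node p-node))

module Normalisation (em : ExcludedMiddle a) {K : Set c} (T : Tree K k)
  (monomials : Fin k → List (Monomial k))
  (mon-∈ : ∀ v → Node T v → mon T v ∈ monomials (Tree.var T v)) where

  open Tree T
  open Classical em

  Recurrent : Fin k → Set
  Recurrent Y = ∃ λ m → InfinitelyMany (Occurrence T m Y)

  mon-∈-of-var : ∀ {v Y} → Node T v → var v ≡ Y → mon T v ∈ monomials Y
  mon-∈-of-var v-node refl = mon-∈ _ v-node

  infinitely-many⇒recurrent : ∀ {Y} → InfinitelyMany (λ v → Node T v × var v ≡ Y) → Recurrent Y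
  infinitely-many⇒recurrent {Y} nodes
    with m , cof ← cofinal-pigeonhole (monomials Y) (mon T ∘ elem nodes)
                     (λ i → let (v-node , v-var) = elem-satisfies nodes i in mon-∈-of-var v-node v-var)
    with σ , σ-injective , σ-mon ← cofinal⇒subsequence cof
    = m , record
      { elem           = elem nodes ∘ σ
      ; elem-injective = σ-injective ∘ elem-injective nodes
      ; elem-satisfies = λ n → let (v-node , v-var) = elem-satisfies nodes (σ n) in v-node , v-var , σ-mon n
      }

  children-recurrent : ∀ {m Y x i} → InfinitelyMany (Occurrence T m Y) → mon T x ≡ m → i < arity x →
    Recurrent (var (i ∷ x))
  children-recurrent {x = x} {i} occ x-mon i<arity = infinitely-many⇒recurrent (record
    { elem           = λ n → proj₁ (matching-child n) ∷ elem occ n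
    ; elem-injective = elem-injective occ ∘ proj₂ ∘ ∷-injective
    ; elem-satisfies = λ n → let (j , j<arity , j-var) = matching-child n in
        (proj₁ (elem-satisfies occ n) , j<arity) , j-var
    })
    where
    matching-child : ∀ n → ∃ λ j → j < arity (elem occ n) × var (j ∷ elem occ n) ≡ var (i ∷ x)
    matching-child n = let (_ , _ , n-mon) = elem-satisfies occ n in
      mon-≡⇒child T (trans n-mon (sym x-mon)) i<arity

  Lowest : Address → Set
  Lowest w = ∀ {x} → x ≺ w → Node T x → ¬ var x ≡ var w

  LowestDescendant : Address → Set
  LowestDescendant u = ∃ λ w → w ≼ u × Node T w × var w ≡ var u × Lowest w

  -- Otherwise the occurrences of var u below u form an infinite descending chain.
  lowest-descendant : ∀ {u} → Node T u → ¬ Recurrent (var u) → LowestDescendant u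
  lowest-descendant {u} u-node ¬rec with decide (LowestDescendant u)
  ... | yes lowest = lowest
  ... | no ¬lowest = ⊥-elim (¬rec (infinitely-many⇒recurrent (record
    { elem           = proj₁ ∘ chain
    ; elem-injective = λ eq → increasing⇒injective (length ∘ proj₁ ∘ chain)
                                (≺-length ∘ proj₂ ∘ deeper ∘ chain) (cong length eq)
    ; elem-satisfies = λ n → let (_ , _ , x-node , x-var) = chain n in x-node , x-var
    })))
    where
    Candidate : Set
    Candidate = ∃ λ x → x ≼ u × Node T x × var x ≡ var u
    deeper : (x : Candidate) → Σ Candidate λ y → proj₁ y ≺ proj₁ x
    deeper (x , x≼u , x-node , x-var) with decide (∃ λ y → y ≺ x × Node T y × var y ≡ var u)
    ... | yes (y , y≺x , y-node , y-var) = (y , ≼-trans (≺⇒≼ y≺x) x≼u , y-node , y-var) , y≺x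
    ... | no ¬deeper = ⊥-elim (¬lowest (x , x≼u , x-node , x-var ,
            λ y≺x y-node y-var → ¬deeper (_ , y≺x , y-node , trans y-var x-var)))
    chain : ℕ → Candidate
    chain zero    = u , ≼-refl , u-node , refl
    chain (suc n) = proj₁ (deeper (chain n))

  jump : Address → Address
  jump u with decide (LowestDescendant u)
  ... | yes (w , _) = w
  ... | no _        = u

  jump-≼ : ∀ u → jump u ≼ u
  jump-≼ u with decide (LowestDescendant u)
  ... | yes (_ , w≼u , _) = w≼u
  ... | no _              = ≼-refl

  jump-var : ∀ u → var (jump u) ≡ var u
  jump-var u with decide (LowestDescendant u)
  ... | yes (_ , _ , _ , w-var , _) = w-var
  ... | no _                        = refl

  jump-lowest : ∀ {u} → Node T u → ¬ Recurrent (var u) → Node T (jump u) × Lowest (jump u)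
  jump-lowest {u} u-node ¬rec with decide (LowestDescendant u)
  ... | yes (_ , _ , w-node , _ , w-lowest) = w-node , w-lowest
  ... | no ¬lowest = ⊥-elim (¬lowest (lowest-descendant u-node ¬rec))

  representative : Fin k → Address
  representative Y with decide (Recurrent Y)
  ... | yes (_ , occ) = elem occ 0
  ... | no _          = []   -- junk, only consulted for recurrent Y

  representative-recurs : ∀ {Y} → Recurrent Y →
    Occurrence T (mon T (representative Y)) Y (representative Y) ×
    InfinitelyMany (Occurrence T (mon T (representative Y)) Y)
  representative-recurs {Y} rec with decide (Recurrent Y)
  ... | no ¬rec = ⊥-elim (¬rec rec)
  ... | yes (m , occ) with x-node , x-var , x-mon ← elem-satisfies occ 0 =
    (x-node , x-var , refl) , subst (λ m → InfinitelyMany (Occurrence T m Y)) (sym x-mon) occ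

  representative-var : ∀ {Y} → Recurrent Y → var (representative Y) ≡ Y
  representative-var = proj₁ ∘ proj₂ ∘ proj₁ ∘ representative-recurs

  normalise : Address → Address
  normalise u with decide (Recurrent (var u))
  ... | yes _ = representative (var u)
  ... | no _  = jump u

  normalise-var : ∀ u → var (normalise u) ≡ var u
  normalise-var u with decide (Recurrent (var u))
  ... | yes rec = representative-var rec
  ... | no _    = jump-var u

  normalise-node : ∀ {u} → Node T u → Node T (normalise u)
  normalise-node {u} u-node with decide (Recurrent (var u))
  ... | yes rec  = proj₁ (proj₁ (representative-recurs rec))
  ... | no ¬rec  = proj₁ (jump-lowest u-node ¬rec)

  normalise-recurrent : ∀ u → Recurrent (var (normalise u)) → normalise u ≡ representative (var (normalise u))
  normalise-recurrent u rec′ with decide (Recurrent (var u))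
  ... | yes rec = cong representative (sym (representative-var rec))
  ... | no ¬rec = ⊥-elim (¬rec (subst Recurrent (jump-var u) rec′))

  normalise-non-recurrent : ∀ u → ¬ Recurrent (var (normalise u)) → normalise u ≡ jump u
  normalise-non-recurrent u ¬rec′ with decide (Recurrent (var u))
  ... | yes rec = ⊥-elim (¬rec′ (subst Recurrent (sym (representative-var rec)) rec))
  ... | no _    = refl

  normalise-lowest : ∀ {u} → Node T u → ¬ Recurrent (var (normalise u)) → Lowest (normalise u)
  normalise-lowest {u} u-node ¬rec = subst Lowest (sym (normalise-non-recurrent u ¬rec))
    (proj₂ (jump-lowest u-node (¬rec ∘ subst Recurrent (sym (normalise-var u)))))

  source : Address → Address
  source = follow normalise

  T′ : Tree K k
  T′ = relabel source T

  source-node : ∀ {p} → Node T′ p → Node T (source p)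
  source-node {[]}    _              = normalise-node tt
  source-node {_ ∷ _} (p-node , lt) = normalise-node (source-node p-node , lt)

  mon-T′ : ∀ p → mon T′ p ≡ mon T (source p)
  mon-T′ p = mon-relabel T source p (λ i → normalise-var (i ∷ source p))

  source-recurrent : ∀ p → Recurrent (var (source p)) → source p ≡ representative (var (source p))
  source-recurrent []      = normalise-recurrent []
  source-recurrent (i ∷ p) = normalise-recurrent (i ∷ source p)

  mon-T′-recurrent : ∀ u {Y} → var (source u) ≡ Y → Recurrent Y → mon T′ u ≡ mon T (representative Y)
  mon-T′-recurrent u refl rec = trans (mon-T′ u) (cong (mon T) (source-recurrent u rec))

  recurrent-child : ∀ {i p} → Node T′ (i ∷ p) → Recurrent (var (source p)) → Recurrent (var (source (i ∷ p)))
  recurrent-child {i} {p} (_ , i<arity) rec = subst Recurrent (sym (normalise-var (i ∷ source p)))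
    (children-recurrent (proj₂ (representative-recurs rec)) (cong (mon T) (source-recurrent p rec)) i<arity)

  recurrent-descendant : ∀ {u v} → u ≼ v → Node T′ u → Recurrent (var (source v)) → Recurrent (var (source u))
  recurrent-descendant ([] , refl)    _                  rec = rec
  recurrent-descendant (_ ∷ q , refl) u-node@(q-node , _) rec =
    recurrent-child u-node (recurrent-descendant (q , refl) q-node rec)

  source-follows-jump : ∀ p → Node T′ p → ¬ Recurrent (var (source p)) → source p ≡ follow jump p
  source-follows-jump []      _                  ¬rec = normalise-non-recurrent [] ¬rec
  source-follows-jump (i ∷ p) ip-node@(p-node , _) ¬rec = begin
    normalise (i ∷ source p)    ≡⟨ normalise-non-recurrent (i ∷ source p) ¬rec ⟩
    jump (i ∷ source p)         ≡⟨ cong (jump ∘ (i ∷_)) (source-follows-jump p p-node (¬rec ∘ recurrent-child ip-node)) ⟩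
    jump (i ∷ follow jump p)    ∎
    where open ≡-Reasoning

  source-injective : ∀ {u w} → Node T′ u → Node T′ w → ¬ Recurrent (var (source u)) → ¬ Recurrent (var (source w)) →
    source u ≡ source w → u ≡ w
  source-injective {u} {w} u-node w-node ¬rec-u ¬rec-w same = follow-injective jump-≼
    (trans (sym (source-follows-jump u u-node ¬rec-u)) (trans same (source-follows-jump w w-node ¬rec-w)))

  source-lowest : ∀ p → Node T′ p → ¬ Recurrent (var (source p)) → Lowest (source p)
  source-lowest []      _             = normalise-lowest tt
  source-lowest (_ ∷ p) (p-node , lt) = normalise-lowest (source-node p-node , lt)

  -- source u lies strictly below source v, which is a lowest occurrence of its variable.
  var-source-≺ : ∀ {u v} → u ≺ v → Node T′ u → ¬ Recurrent (var (source u)) → ¬ var (source u) ≡ var (source v)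
  var-source-≺ {u} {v} u≺v@(r , j , refl) u-node ¬rec =
    source-lowest v v-node ¬rec-v source-≺ (source-node u-node)
    where
    v-node : Node T′ v
    v-node = Node-≼ T′ (≺⇒≼ u≺v) u-node
    ¬rec-v : ¬ Recurrent (var (source v))
    ¬rec-v = ¬rec ∘ recurrent-descendant (≺⇒≼ u≺v) u-node
    source-≺ : source u ≺ source v
    source-≺ with q , eq ← follow-descends jump-≼ r j v = q , j ,
      trans (source-follows-jump u u-node ¬rec)
        (trans eq (cong (λ x → q ++ j ∷ x) (sym (source-follows-jump v v-node ¬rec-v))))

  -- Pigeonhole on the variables of the k + 1 nodes on the path to p.
  depth-recurrent : ∀ {p} → Node T′ p → length p ≡ k → Recurrent (var (source p))
  depth-recurrent {p} p-node |p|≡k with decide (Recurrent (var (source p)))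
  ... | yes rec = rec
  ... | no ¬rec with i , j , i<j , same ← pigeonhole (n<1+n k) (λ i → var (source (drop (toℕ i) p))) =
    ⊥-elim (var-source-≺ (drop-≺ p i<j (subst (toℕ j ≤_) (sym |p|≡k) (≤-pred (toℕ<n j))))
                         (Node-≼ T′ (drop-≼ (toℕ i) p) p-node)
                         (¬rec ∘ recurrent-descendant (drop-≼ (toℕ i) p) p-node)
                         same)

  recurrent-below-depth : ∀ {u v} → Node T′ v → length v ≡ k → u ≼ v → Node T′ u → Recurrent (var (source u))
  recurrent-below-depth v-node |v|≡k u≼v u-node = recurrent-descendant u≼v u-node (depth-recurrent v-node |v|≡k)

  deterministic-below-depth : ∀ {v} → Node T′ v → length v ≡ k → DeterministicAt T′ v
  deterministic-below-depth v-node |v|≡k u w u-node w-node u≼v w≼v same-var =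
    trans (mon-T′-recurrent u same-var rec-w) (sym (mon-T′-recurrent w refl rec-w))
    where rec-w = recurrent-below-depth v-node |v|≡k w≼v w-node

  infinitely-often-below-depth : ∀ {v} → Node T′ v → length v ≡ k →
    ∀ u → Node T′ u → u ≼ v → InfinitelyOften T (mon T′ u) (Tree.var T′ u)
  infinitely-often-below-depth v-node |v|≡k u u-node u≼v =
    subst (λ m → InfinitelyOften T m (var (source u))) (sym (mon-T′-recurrent u refl rec))
      (InfinitelyMany⇒InfinitelyOften T (proj₂ (representative-recurs rec)))
    where rec = recurrent-below-depth v-node |v|≡k u≼v u-node

  AtLeast-T′⇒AtLeast-T : ∀ {n m Y} → AtLeast T′ n m Y → AtLeast T n m Y
  AtLeast-T′⇒AtLeast-T {n} {m} {Y} (f , f-injective , f-occ) with decide (Recurrent Y)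
  ... | yes rec with g , g-injective , g-occ ← InfinitelyMany⇒InfinitelyOften T (proj₂ (representative-recurs rec)) n =
    g , g-injective , λ i → let (g-node , g-var , g-mon) = g-occ i in g-node , g-var , trans g-mon (representative-mon i)
    where
    representative-mon : Fin n → mon T (representative Y) ≡ m
    representative-mon i = let (_ , f-var , f-mon) = f-occ i in trans (sym (mon-T′-recurrent (f i) f-var rec)) f-mon
  ... | no ¬rec = source ∘ f , injective , λ i → let (f-node , f-var , f-mon) = f-occ i in
    source-node f-node , f-var , trans (sym (mon-T′ (f i))) f-mon
    where
    ¬rec-f : ∀ i → ¬ Recurrent (var (source (f i)))
    ¬rec-f i = ¬rec ∘ subst Recurrent (proj₁ (proj₂ (f-occ i)))
    injective : Injective _≡_ _≡_ (source ∘ f)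
    injective {i} {j} = f-injective ∘ source-injective (proj₁ (f-occ i)) (proj₁ (f-occ j)) (¬rec-f i) (¬rec-f j)

lemma25 : ∀ {c ℓ} (R : CommutativeSemiring c ℓ) → ExcludedMiddle (c ⊔ ℓ) →
    Absorptive R → FullyContinuous R →
    (k : ℕ) (E : EqSystem R k) (X : Fin k)
    (T : Tree (CommutativeSemiring.Carrier R) k) → Compatible R E X T →
    Σ (Tree (CommutativeSemiring.Carrier R) k) λ T' →
      Compatible R E X T' ×
      (∀ v → Node T' v → length v ≡ k →
        DeterministicAt T' v ×
        (∀ u → Node T' u → u ≼ v → InfinitelyOften T (mon T' u) (Tree.var T' u))) ×
      (∀ Y m → MonOf R m (EqSystem.P E Y) → ∀ n →
        AtLeast T' n m Y → AtLeast T n m Y)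
lemma25 R em _ _ k E X T T-compatible =
  T′ ,
  relabel-compatible R E source T-compatible (normalise-var []) source-node mon-T′ ,
  (λ v v-node |v|≡k → deterministic-below-depth v-node |v|≡k , infinitely-often-below-depth v-node |v|≡k) ,
  λ _ _ _ _ → AtLeast-T′⇒AtLeast-T
  where open Normalisation em T (map proj₂ ∘ EqSystem.P E) (compatible⇒mon-∈ R E T-compatible)
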